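{- For every integer $m\ge 1$, the cycle chain $\mathcal{C}_8^m$ has a prime vertex labeling.
   Context: All graphs are simple and connected. A graph with $N$ vertices has a prime vertex labeling if its vertices can be labeled bijectively with $1,2,\ldots,N$ so that adjacent vertices receive relatively prime labels. For even $n\ge 4$ and $m\ge 1$, the cycle chain $\mathcal{C}_n^m$ consists of $m$ copies $C^{(1)},\ldots,C^{(m)}$ of the $n$-cycle such that consecutive cycles $C^{(i)}$ and $C^{(i+1)}$ share exactly one common vertex, non-consecutive cycles share no vertex, and in each cycle $C^{(i)}$ with $1<i<m$ the two shared vertices (the one shared with $C^{(i-1)}$ and the one shared with $C^{(i+1)}$) are at distance $n/2$ in that cycle, i.e. they split it into two paths of equal length $n/2$. It has $m(n-1)+1$ vertices. -}

module Defs where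

open import Data.Nat using (ℕ; zero; suc; _+_; _*_; _∸_; _<_; _<ᵇ_; _≡ᵇ_)
open import Data.Nat.Coprimality using (Coprime)
open import Data.Fin using (Fin; toℕ)
open import Data.Bool using (if_then_else_)
open import Data.Product using (Σ; ∃; _×_)
open import Data.Sum using (_⊎_)
open import Function using (Bijective)
open import Relation.Binary.PropositionalEquality using (_≡_)

record Graph : Set₁ where
  field
    size : ℕ
    Adj  : Fin size → Fin size → Set

-- Prime vertex labeling: a bijection from the vertices onto the labels
-- 1,…,N (label of v is 1 + toℕ (f v)), adjacent vertices get coprime labels.
PrimeLabeling : Graph → Set
PrimeLabeling G =
  Σ (Fin size → Fin size) λ f →
    Bijective _≡_ _≡_ f ×
    (∀ u v → Adj u v → Coprime (suc (toℕ (f u))) (suc (toℕ (f v))))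
  where open Graph G

HasPrimeLabeling : Graph → Set
HasPrimeLabeling = PrimeLabeling

-- Cycle chain C_n^m with n = 2h (h ≥ 2), m ≥ 1, on vertices 0,…,m(n-1).
-- Cycle i (0 ≤ i < m) has base b = i(n-1); its n vertices in cyclic order are
--   b, b+1, …, b+h-1, b+2h-1, b+2h-2, …, b+h
-- i.e. position k ↦ b+k for k < h and b+(3h-1-k) for h ≤ k < 2h.
-- Cycle i and i+1 share exactly the vertex (i+1)(n-1), which in cycle i sits at
-- position h and in cycle i+1 at position 0: distance h = n/2.
cycPos : (h i k : ℕ) → ℕ
cycPos h i k = i * (2 * h ∸ 1) + (if k <ᵇ h then k else (3 * h ∸ 1) ∸ k)

nextPos : (h k : ℕ) → ℕ
nextPos h k = if suc k ≡ᵇ 2 * h then 0 else suc k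

ChainAdj : (h m : ℕ) → ℕ → ℕ → Set
ChainAdj h m u v =
  ∃ λ i → ∃ λ k → i < m × k < 2 * h ×
    ((u ≡ cycPos h i k × v ≡ cycPos h i (nextPos h k)) ⊎
     (v ≡ cycPos h i k × u ≡ cycPos h i (nextPos h k)))

CycleChain : (h m : ℕ) → Graph
CycleChain h m = record
  { size = m * (2 * h ∸ 1) + 1
  ; Adj  = λ u v → ChainAdj h m (toℕ u) (toℕ v)
  }

module Submission where

-- Vertex v of CycleChain 4 m (v = 0 … 7m) receives the label 1 + σ v,
-- where σ is the involution of ℕ that reverses the segment 4, 5, 6, 7 of
-- every block of 14 consecutive numbers and fixes everything else.  With
-- this choice the even-numbered cycles are labelled a, a+1, …, a+7 in
-- cyclic order (a ≡ 1 mod 7), and along every edge of every cycle the two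
-- labels differ by 1, 4 or 7, the smaller one being coprime to the gap.

open import Defs
open import Data.Nat using (ℕ; NonZero; zero; suc; _+_; _*_; _∸_; _≤_; _<_; _≥_; _≤?_; _<?_)
open import Data.Nat.Properties
  using (_≟_; allUpTo?; m≤m+n; <-≤-trans; ≮⇒≥; +-cancelˡ-<; +-monoʳ-<; m+[n∸m]≡n; +-assoc; +-comm; +-suc)
open import Data.Nat.Divisibility using (_∣_; _∣?_; ∣-trans; ∣m+n∣m⇒∣n; n∣m*n)
open import Data.Nat.DivMod using (_/_; _%_; m≡m%n+[m/n]*n; m%n<n)
open import Data.Nat.Coprimality as Coprimality using (Coprime; coprime?; coprime-+)
open import Data.Nat.Solver using (module +-*-Solver)
open import Data.Fin using (Fin; toℕ; fromℕ<)
open import Data.Fin.Properties using (toℕ<n; toℕ-fromℕ<; toℕ-injective)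
open import Data.Product using (_×_; _,_)
open import Data.Sum using (_⊎_; inj₁; inj₂)
open import Function using (Bijective)
open import Function.Consequences.Propositional
  using (inverseᵇ⇒bijective; strictlyInverseˡ⇒inverseˡ; strictlyInverseʳ⇒inverseʳ)
open import Relation.Nullary using (Dec; yes; no)
open import Relation.Nullary.Decidable using (from-yes; _×-dec_; _⊎-dec_)
open import Relation.Binary.PropositionalEquality
  using (_≡_; refl; sym; trans; cong; subst; subst₂; module ≡-Reasoning)

coprime-shift : ∀ {P d} q x → d ∣ P → Coprime x d → Coprime (q * P + x) d
coprime-shift q x d∣P x⊥d (i∣qP+x , i∣d) =
  x⊥d (∣m+n∣m⇒∣n i∣qP+x (∣-trans i∣d (∣-trans d∣P (n∣m*n q))) , i∣d)

coprime-gap : ∀ x d → Coprime x d → Coprime x (x + d)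
coprime-gap x d x⊥d = Coprimality.sym (coprime-+ (Coprimality.sym x⊥d))

GoodGap : ℕ → ℕ → ℕ → Set
GoodGap P x y = x ≤ y × (y ∸ x) ∣ P × Coprime x (y ∸ x)

GoodPair : ℕ → ℕ → ℕ → Set
GoodPair P x y = GoodGap P x y ⊎ GoodGap P y x

goodPair? : ∀ P x y → Dec (GoodPair P x y)
goodPair? P x y = gap? x y ⊎-dec gap? y x
  where
  gap? : ∀ a b → Dec (GoodGap P a b)
  gap? a b = (a ≤? b) ×-dec ((b ∸ a) ∣? P) ×-dec coprime? a (b ∸ a)

goodGap-coprime : ∀ {P x y} q → GoodGap P x y → Coprime (q * P + x) (q * P + y)
goodGap-coprime {P} {x} {y} q (x≤y , gap∣P , x⊥gap) =
  subst (Coprime (q * P + x)) shifted-y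
    (coprime-gap (q * P + x) (y ∸ x) (coprime-shift q x gap∣P x⊥gap))
  where
  shifted-y : q * P + x + (y ∸ x) ≡ q * P + y
  shifted-y = trans (+-assoc (q * P) x (y ∸ x)) (cong (q * P +_) (m+[n∸m]≡n x≤y))

goodPair-coprime : ∀ {P x y} q → GoodPair P x y → Coprime (q * P + x) (q * P + y)
goodPair-coprime q (inj₁ gap) = goodGap-coprime q gap
goodPair-coprime q (inj₂ gap) = Coprimality.sym (goodGap-coprime q gap)

Closed : (ℕ → ℕ) → ℕ → Set
Closed f N = ∀ {n} → n < N → f n < N

closed? : ∀ f N → Dec (Closed f N)
closed? f N = allUpTo? (λ n → f n <? N) N

restrict : ∀ {N} (f : ℕ → ℕ) → Closed f N → Fin N → Fin N
restrict f closed v = fromℕ< (closed (toℕ<n v))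

toℕ-restrict : ∀ {N} (f : ℕ → ℕ) (closed : Closed f N) v →
               toℕ (restrict f closed v) ≡ f (toℕ v)
toℕ-restrict f closed v = toℕ-fromℕ< (closed (toℕ<n v))

restrict-bijective : ∀ {N} (f : ℕ → ℕ) (closed : Closed f N) →
                     (∀ n → f (f n) ≡ n) → Bijective _≡_ _≡_ (restrict f closed)
restrict-bijective f closed f-involutive =
  inverseᵇ⇒bijective (strictlyInverseˡ⇒inverseˡ g involutive ,
                      strictlyInverseʳ⇒inverseʳ g involutive)
  where
  g : Fin _ → Fin _
  g = restrict f closed
  involutive : ∀ v → g (g v) ≡ v
  involutive v = toℕ-injective (begin
    toℕ (g (g v))  ≡⟨ toℕ-restrict f closed (g v) ⟩
    f (toℕ (g v))  ≡⟨ cong f (toℕ-restrict f closed v) ⟩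
    f (f (toℕ v))  ≡⟨ f-involutive (toℕ v) ⟩
    toℕ v          ∎)
    where open ≡-Reasoning

σ : ℕ → ℕ
σ 4 = 7
σ 5 = 6
σ 6 = 5
σ 7 = 4
σ (suc (suc (suc (suc (suc (suc (suc (suc (suc (suc (suc (suc (suc (suc n)))))))))))))) = 14 + σ n
σ n = n

label : ℕ → ℕ
label v = suc (σ v)

σ-period : ∀ q c → σ (q * 28 + c) ≡ q * 28 + σ c
σ-period zero    c = refl
σ-period (suc q) c = cong (28 +_) (σ-period q c)

label-period : ∀ q c → label (q * 28 + c) ≡ q * 28 + label c
label-period q c = trans (cong suc (σ-period q c)) (sym (+-suc (q * 28) (σ c)))

-- Division with remainder, in the form q · p + r matching σ-period.
div-split : ∀ n p .{{_ : NonZero p}} → n ≡ (n / p) * p + n % p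
div-split n p = trans (m≡m%n+[m/n]*n n p) (+-comm (n % p) ((n / p) * p))

σ-involutive-on-period : ∀ {c} → c < 28 → σ (σ c) ≡ c
σ-involutive-on-period = from-yes (allUpTo? (λ c → σ (σ c) ≟ c) 28)

σ-involutive : ∀ n → σ (σ n) ≡ n
σ-involutive n = begin
  σ (σ n)            ≡⟨ cong (λ v → σ (σ v)) (div-split n 28) ⟩
  σ (σ (q * 28 + c)) ≡⟨ cong σ (σ-period q c) ⟩
  σ (q * 28 + σ c)   ≡⟨ σ-period q (σ c) ⟩
  q * 28 + σ (σ c)   ≡⟨ cong (q * 28 +_) (σ-involutive-on-period (m%n<n n 28)) ⟩
  q * 28 + c         ≡⟨ sym (div-split n 28) ⟩
  n                  ∎
  where
  open ≡-Reasoning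
  q c : ℕ
  q = n / 28
  c = n % 28

-- If σ keeps [0, b) then it keeps [0, 28 + b): small numbers stay below 28,
-- and σ (28 + n) = 28 + σ n.
closed-step : ∀ {b} → Closed σ b → Closed σ (28 + b)
closed-step {b} closed {n} n<28+b with n <? 28
... | yes n<28 = <-≤-trans (from-yes (closed? σ 28) n<28) (m≤m+n 28 b)
... | no  n≮28 = subst (λ v → σ v < 28 + b) split (+-monoʳ-< 28 (closed rest<b))
  where
  split : 28 + (n ∸ 28) ≡ n
  split = m+[n∸m]≡n (≮⇒≥ n≮28)
  rest<b : n ∸ 28 < b
  rest<b = +-cancelˡ-< 28 (n ∸ 28) b (subst (_< 28 + b) (sym split) n<28+b)

closed-chain : ∀ m → Closed σ (m * 7 + 1)
closed-chain 0 = from-yes (closed? σ 1)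
closed-chain 1 = from-yes (closed? σ 8)
closed-chain 2 = from-yes (closed? σ 15)
closed-chain 3 = from-yes (closed? σ 22)
closed-chain (suc (suc (suc (suc m)))) = closed-step (closed-chain m)

EdgeLabels : (ℕ → ℕ → Set) → ℕ → ℕ → Set
EdgeLabels R i k = R (label (cycPos 4 i k)) (label (cycPos 4 i (nextPos 4 k)))

edgeLabels? : ∀ {R} → (∀ x y → Dec (R x y)) → ∀ i k → Dec (EdgeLabels R i k)
edgeLabels? R? i k = R? (label (cycPos 4 i k)) (label (cycPos 4 i (nextPos 4 k)))

first-cycles-good : ∀ {s} → s < 4 → ∀ {k} → k < 8 → EdgeLabels (GoodPair 28) s k
first-cycles-good =
  from-yes (allUpTo? (λ s → allUpTo? (edgeLabels? (goodPair? 28) s) 8) 4)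

cycPos-period : ∀ q s k → cycPos 4 (q * 4 + s) k ≡ q * 28 + cycPos 4 s k
cycPos-period q s k = solve 3 (λ q s o → (q :* con 4 :+ s) :* con 7 :+ o
                                      := q :* con 28 :+ (s :* con 7 :+ o)) refl q s _
  where open +-*-Solver

edge-coprime : ∀ i {k} → k < 8 → EdgeLabels Coprime i k
edge-coprime i {k} k<8 =
  subst₂ Coprime (sym (translate k)) (sym (translate (nextPos 4 k)))
    (goodPair-coprime q (first-cycles-good (m%n<n i 4) k<8))
  where
  q s : ℕ
  q = i / 4
  s = i % 4
  translate : ∀ k′ → label (cycPos 4 i k′) ≡ q * 28 + label (cycPos 4 s k′)
  translate k′ = trans (cong (λ j → label (cycPos 4 j k′)) (div-split i 4))
                       (trans (cong label (cycPos-period q s k′))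
                              (label-period q (cycPos 4 s k′)))

chain-edge-coprime : ∀ {m u v} → ChainAdj 4 m u v → Coprime (label u) (label v)
chain-edge-coprime (i , k , _ , k<8 , inj₁ (refl , refl)) = edge-coprime i k<8
chain-edge-coprime (i , k , _ , k<8 , inj₂ (refl , refl)) =
  Coprimality.sym (edge-coprime i k<8)

-- The restriction of σ to {0, …, 7m} is the required labelling; the
-- construction works for every m.
theorem4 : ∀ (m : ℕ) → m ≥ 1 → HasPrimeLabeling (CycleChain 4 m)
theorem4 m _ = f , restrict-bijective σ closed σ-involutive , adjacent-coprime
  where
  closed : Closed σ (m * 7 + 1)
  closed = closed-chain m
  f : Fin (m * 7 + 1) → Fin (m * 7 + 1)
  f = restrict σ closed
  adjacent-coprime : ∀ u v → ChainAdj 4 m (toℕ u) (toℕ v) →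
                     Coprime (suc (toℕ (f u))) (suc (toℕ (f v)))
  adjacent-coprime u v adj =
    subst₂ Coprime (cong suc (sym (toℕ-restrict σ closed u)))
                   (cong suc (sym (toℕ-restrict σ closed v)))
                   (chain-edge-coprime adj)
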